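{- Let $\alpha$ be a composition of $n$, $\sigma\in\mathfrak{S}_{\ell(\alpha)}$ and $\tau\in\mathrm{SPCT}^\sigma(\alpha)$. (1) If $j\in\mathrm{des}(\tau)$ and $j$ and $j+1$ are nonattacking, then $s_j(\tau)\in\mathrm{SPCT}^\sigma(\alpha)$. (2) If $j\notin\mathrm{des}(\tau)$ and $j$ is not in the cell immediately to the right of the cell containing $j+1$, then $s_j(\tau)\in\mathrm{SPCT}^\sigma(\alpha)$.
   Context: A composition $\alpha=(\alpha_1,\dots,\alpha_k)$ of $n$ is a sequence of positive integers with sum $n$; $\ell(\alpha)=k$. Its composition diagram is the left-justified array whose $i$-th row from the top has $\alpha_i$ cells. The standardization of a word $w_1\cdots w_m$ of positive integers is the unique $\pi\in\mathfrak{S}_m$ with $\pi(i)>\pi(j)$ iff $w_i>w_j$ for $i<j$. For $\sigma\in\mathfrak{S}_{\ell(\alpha)}$, $\mathrm{SPCT}^\sigma(\alpha)$ is the set of fillings of the diagram of $\alpha$ with distinct positive integers at most $n$ such that: the standardization of the first column read top to bottom is $\sigma$; rows weakly decrease left to right; and (triple condition) whenever $i<r$ and cells $(i,j),(i,j+1),(r,j+1)$ lie in the diagram with entries $a,b,c$, $a\ge c$ implies $b>c$. For such $\tau$ and $1\le j\le n-1$: $j\in\mathrm{des}(\tau)$ if $j+1$ lies in a column weakly to the right of the column of $j$; $j$ and $j+1$ are attacking if they lie in the same column, or $j+1$ lies in the column immediately right of that of $j$ and in a row strictly below the row of $j$; otherwise they are nonattacking. $s_j(\tau)$ is the filling obtained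 from $\tau$ by swapping the positions of $j$ and $j+1$. -}

module Defs where

open import Data.Nat using (ℕ; zero; suc; _≤_; _<_; _>_; _≡ᵇ_)
open import Data.Nat.ListAction using (sum)
open import Data.List using (List; []; _∷_; length)
open import Data.List.Relation.Unary.All using (All)
open import Data.Fin using (Fin; toℕ) renaming (_<_ to _<ᶠ_; _>_ to _>ᶠ_)
open import Data.Fin.Permutation using (Permutation′; _⟨$⟩ʳ_)
open import Data.Product using (_×_; ∃-syntax)
open import Data.Sum using (_⊎_)
open import Data.Bool using (if_then_else_)
open import Relation.Binary.PropositionalEquality using (_≡_)
open import Relation.Nullary using (¬_)
open import Function.Bundles using (_⇔_)

-- A composition: a list of positive integers.  It is a composition of  sum α.
IsComposition : List ℕ → Set
IsComposition α = All (λ a → 0 < a) α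

ℓ : List ℕ → ℕ
ℓ = length

-- length of row r (rows 0-indexed from the top); 0 outside the diagram
rowLen : List ℕ → ℕ → ℕ
rowLen []      _       = 0
rowLen (a ∷ α) zero    = a
rowLen (a ∷ α) (suc r) = rowLen α r

-- cell (r , c) (row r from the top, column c from the left, both 0-indexed)
-- lies in the composition diagram of α
InDiag : List ℕ → ℕ → ℕ → Set
InDiag α r c = (r < length α) × (c < rowLen α r)

-- a filling assigns a value to each position; only the values at cells
-- of the diagram are relevant
Filling : Set
Filling = ℕ → ℕ → ℕ

IsStandardization : {m : ℕ} → (Fin m → ℕ) → Permutation′ m → Set
IsStandardization {m} w π =
  ∀ (i j : Fin m) → i <ᶠ j → ((π ⟨$⟩ʳ i) >ᶠ (π ⟨$⟩ʳ j)) ⇔ (w i > w j)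

firstColumn : (α : List ℕ) → Filling → Fin (length α) → ℕ
firstColumn α τ i = τ (toℕ i) 0

record SPCT (α : List ℕ) (σ : Permutation′ (length α)) (τ : Filling) : Set where
  field
    distinct : ∀ r c r' c' → InDiag α r c → InDiag α r' c' →
               τ r c ≡ τ r' c' → (r ≡ r') × (c ≡ c')
    positive : ∀ r c → InDiag α r c → 1 ≤ τ r c
    bounded  : ∀ r c → InDiag α r c → τ r c ≤ sum α
    firstCol : IsStandardization (firstColumn α τ) σ
    rowDecr  : ∀ r c → InDiag α r (suc c) → τ r (suc c) ≤ τ r c
    -- triple condition: i < r, cells (i,c),(i,c+1),(r,c+1) with entries a,b,c
    triple   : ∀ i r c → i < r → InDiag α i (suc c) → InDiag α r (suc c) →
               τ r (suc c) ≤ τ i c → τ r (suc c) < τ i (suc c)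

At : List ℕ → Filling → ℕ → ℕ → ℕ → Set
At α τ v r c = InDiag α r c × (τ r c ≡ v)

Des : List ℕ → Filling → ℕ → Set
Des α τ j = ∃[ r ] ∃[ c ] ∃[ r' ] ∃[ c' ]
  (At α τ j r c × At α τ (suc j) r' c' × c ≤ c')

Attacking : List ℕ → Filling → ℕ → Set
Attacking α τ j = ∃[ r ] ∃[ c ] ∃[ r' ] ∃[ c' ]
  (At α τ j r c × At α τ (suc j) r' c' ×
   ((c ≡ c') ⊎ ((c' ≡ suc c) × (r < r'))))

Nonattacking : List ℕ → Filling → ℕ → Set
Nonattacking α τ j = ¬ Attacking α τ j

JRightOfJ+1 : List ℕ → Filling → ℕ → Set
JRightOfJ+1 α τ j = ∃[ r ] ∃[ c ] (At α τ (suc j) r c × At α τ j r (suc c))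

s : ℕ → Filling → Filling
s j τ r c = if τ r c ≡ᵇ j then suc j
            else (if τ r c ≡ᵇ suc j then j else τ r c)

-- The map s_j exchanges the adjacent values j and j+1, so it preserves every
-- comparison (strict or weak) between two entries except one between the entry
-- j and the entry j+1.  Every SPCT condition compares two cells in one of three
-- relative positions: the same column (first-column standardization, and b
-- versus c in the triple condition), (i,c) against (r,c+1) with i < r (a versus
-- c in the triple condition), and horizontally adjacent cells (rows).  Under
-- either hypothesis of the lemma, j and j+1 sit in none of these relative
-- positions, so s_j(τ) satisfies every condition.
module Submission where

open import Defs
open import Data.Nat using (ℕ; zero; suc; _≤_; _<_; _≡ᵇ_; s≤s; z≤n)
open import Data.Nat.Properties
  using (≡ᵇ⇒≡; ≡⇒≡ᵇ; ≤-refl; ≤-reflexive; ≤-trans; ≤-pred; n≤1+n; 1+n≰n;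
         <⇒≤; <⇒≢; ≤∧≢⇒<)
open import Data.Nat.ListAction using (sum)
open import Data.List using (List; length)
open import Data.List.Relation.Unary.All using (_∷_)
open import Data.Fin using (Fin; toℕ)
open import Data.Fin.Properties using (toℕ<n)
open import Data.Fin.Permutation using (Permutation′)
open import Data.Product using (_×_; _,_; proj₂)
open import Data.Sum using (_⊎_; inj₁; inj₂)
open import Data.Bool using (true; false; if_then_else_; T)
open import Data.Empty using (⊥-elim)
open import Relation.Nullary using (¬_)
open import Relation.Binary.PropositionalEquality
  using (_≡_; _≢_; refl; sym; trans; cong; subst; subst₂)
open import Function.Base using (_∘_)
open import Function.Bundles using (mk⇔; Equivalence)

swap : ℕ → ℕ → ℕ
swap j v = if v ≡ᵇ j then suc j else (if v ≡ᵇ suc j then j else v)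

data SwapView (j v : ℕ) : ℕ → Set where
  at-j      : v ≡ j → SwapView j v (suc j)
  at-suc-j  : v ≡ suc j → SwapView j v j
  elsewhere : v ≢ j → v ≢ suc j → SwapView j v v

swap-view : ∀ j v → SwapView j v (swap j v)
swap-view j v with v ≡ᵇ j in v≡ᵇj | v ≡ᵇ suc j in v≡ᵇj+1
... | true  | _     = at-j (≡ᵇ⇒≡ v j (subst T (sym v≡ᵇj) _))
... | false | true  = at-suc-j (≡ᵇ⇒≡ v (suc j) (subst T (sym v≡ᵇj+1) _))
... | false | false = elsewhere (λ v≡j → subst T v≡ᵇj (≡⇒≡ᵇ v j v≡j))
                                (λ v≡j+1 → subst T v≡ᵇj+1 (≡⇒≡ᵇ v (suc j) v≡j+1))

swap-j : ∀ j → swap j j ≡ suc j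
swap-j j with swap j j | swap-view j j
... | _ | at-j _          = refl
... | _ | at-suc-j j≡1+j  = ⊥-elim (1+n≰n (≤-reflexive (sym j≡1+j)))
... | _ | elsewhere j≢j _ = ⊥-elim (j≢j refl)

swap-suc-j : ∀ j → swap j (suc j) ≡ j
swap-suc-j j with swap j (suc j) | swap-view j (suc j)
... | _ | at-j 1+j≡j          = ⊥-elim (1+n≰n (≤-reflexive 1+j≡j))
... | _ | at-suc-j _          = refl
... | _ | elsewhere _ 1+j≢1+j = ⊥-elim (1+j≢1+j refl)

swap-elsewhere : ∀ {j v} → v ≢ j → v ≢ suc j → swap j v ≡ v
swap-elsewhere {j} {v} v≢j v≢j+1 with swap j v | swap-view j v
... | _ | at-j v≡j        = ⊥-elim (v≢j v≡j)
... | _ | at-suc-j v≡j+1  = ⊥-elim (v≢j+1 v≡j+1)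
... | _ | elsewhere _ _   = refl

swap-involutive : ∀ j v → swap j (swap j v) ≡ v
swap-involutive j v with swap j v | swap-view j v
... | _ | at-j refl           = swap-suc-j j
... | _ | at-suc-j refl       = swap-j j
... | _ | elsewhere v≢j v≢j+1 = swap-elsewhere v≢j v≢j+1

swap-injective : ∀ j {u v} → swap j u ≡ swap j v → u ≡ v
swap-injective j {u} {v} eq =
  trans (sym (swap-involutive j u)) (trans (cong (swap j) eq) (swap-involutive j v))

swap-mono-≤ : ∀ j {x y} → x ≤ y → ¬ (x ≡ j × y ≡ suc j) → swap j x ≤ swap j y
swap-mono-≤ j {x} {y} x≤y not-j,j+1
  with swap j x | swap-view j x | swap j y | swap-view j y
... | _ | at-j _              | _ | at-j _          = ≤-refl
... | _ | at-j x≡j            | _ | at-suc-j y≡j+1  = ⊥-elim (not-j,j+1 (x≡j , y≡j+1))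
... | _ | at-j refl           | _ | elsewhere y≢j _ = ≤∧≢⇒< x≤y (y≢j ∘ sym)
... | _ | at-suc-j refl       | _ | at-j refl       = ⊥-elim (1+n≰n x≤y)
... | _ | at-suc-j _          | _ | at-suc-j _      = ≤-refl
... | _ | at-suc-j refl       | _ | elsewhere _ _   = ≤-trans (n≤1+n j) x≤y
... | _ | elsewhere _ _       | _ | at-j refl       = ≤-trans x≤y (n≤1+n j)
... | _ | elsewhere _ x≢j+1   | _ | at-suc-j refl   = ≤-pred (≤∧≢⇒< x≤y x≢j+1)
... | _ | elsewhere _ _       | _ | elsewhere _ _   = x≤y

swap-mono-< : ∀ j {x y} → x < y → ¬ (x ≡ j × y ≡ suc j) → swap j x < swap j y
swap-mono-< j x<y not-j,j+1 =
  ≤∧≢⇒< (swap-mono-≤ j (<⇒≤ x<y) not-j,j+1) (<⇒≢ x<y ∘ swap-injective j)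

swap-excluded : ∀ j {x y} → ¬ (x ≡ suc j × y ≡ j) →
                ¬ (swap j x ≡ j × swap j y ≡ suc j)
swap-excluded j {x} {y} not-j+1,j (x′≡j , y′≡j+1) = not-j+1,j
  ( trans (sym (swap-involutive j x)) (trans (cong (swap j) x′≡j) (swap-j j))
  , trans (sym (swap-involutive j y)) (trans (cong (swap j) y′≡j+1) (swap-suc-j j)))

swap-reflects-≤ : ∀ j {x y} → swap j x ≤ swap j y → ¬ (x ≡ suc j × y ≡ j) → x ≤ y
swap-reflects-≤ j {x} {y} x′≤y′ not-j+1,j =
  subst₂ _≤_ (swap-involutive j x) (swap-involutive j y)
    (swap-mono-≤ j x′≤y′ (swap-excluded j not-j+1,j))

swap-reflects-< : ∀ j {x y} → swap j x < swap j y → ¬ (x ≡ suc j × y ≡ j) → x < y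
swap-reflects-< j {x} {y} x′<y′ not-j+1,j =
  subst₂ _<_ (swap-involutive j x) (swap-involutive j y)
    (swap-mono-< j x′<y′ (swap-excluded j not-j+1,j))

swap-positive : ∀ {j v} → 1 ≤ j → 1 ≤ v → 1 ≤ swap j v
swap-positive {j} {v} 1≤j 1≤v with swap j v | swap-view j v
... | _ | at-j _        = s≤s z≤n
... | _ | at-suc-j _    = 1≤j
... | _ | elsewhere _ _ = 1≤v

swap-bounded : ∀ {j v n} → suc j ≤ n → v ≤ n → swap j v ≤ n
swap-bounded {j} {v} j+1≤n v≤n with swap j v | swap-view j v
... | _ | at-j _        = j+1≤n
... | _ | at-suc-j _    = ≤-trans (n≤1+n j) j+1≤n
... | _ | elsewhere _ _ = v≤n

swap-preserves-standardization :
  ∀ {m} j (w : Fin m → ℕ) (π : Permutation′ m) →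
  (∀ i k → ¬ (w i ≡ j × w k ≡ suc j)) →
  IsStandardization w π → IsStandardization (swap j ∘ w) π
swap-preserves-standardization j w π j,j+1∉w std i k i<k = mk⇔
  (λ πi>πk → swap-mono-< j (Equivalence.to (std i k i<k) πi>πk) (j,j+1∉w k i))
  (λ w′i>w′k → Equivalence.from (std i k i<k)
                 (swap-reflects-< j w′i>w′k
                   (λ (wk≡j+1 , wi≡j) → j,j+1∉w i k (wi≡j , wk≡j+1))))

rowLen-positive : ∀ {α} → IsComposition α → ∀ {r} → r < length α → 0 < rowLen α r
rowLen-positive (0<a ∷ _)  {zero}  _         = 0<a
rowLen-positive (_ ∷ 0<α)  {suc r} (s≤s r<ℓ) = rowLen-positive 0<α r<ℓ

inDiag-firstColumn : ∀ {α} → IsComposition α → (i : Fin (length α)) → InDiag α (toℕ i) 0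
inDiag-firstColumn comp i = toℕ<n i , rowLen-positive comp (toℕ<n i)

inDiag-left : ∀ α {r c} → InDiag α r (suc c) → InDiag α r c
inDiag-left _ (r<ℓ , c+1<len) = r<ℓ , <⇒≤ c+1<len

At-unique : ∀ {α σ τ v r c r′ c′} → SPCT α σ τ →
            At α τ v r c → At α τ v r′ c′ → r ≡ r′ × c ≡ c′
At-unique sp (d , τrc≡v) (d′ , τr′c′≡v) =
  SPCT.distinct sp _ _ _ _ d d′ (trans τrc≡v (sym τr′c′≡v))

-- The relative positions of j at (r,c) and j+1 at (r′,c′) in which some SPCT
-- condition compares the two entries.
Comparable : (r c r′ c′ : ℕ) → Set
Comparable r c r′ c′ = c ≡ c′ ⊎ (c′ ≡ suc c × r < r′) ⊎ (c ≡ suc c′ × r ≡ r′)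

SwapSafe : List ℕ → Filling → ℕ → Set
SwapSafe α τ j = ∀ {r c r′ c′} → At α τ j r c → At α τ (suc j) r′ c′ →
                 ¬ Comparable r c r′ c′

swap-preserves-SPCT : ∀ {α σ τ j} → IsComposition α → SPCT α σ τ →
                      1 ≤ j → suc j ≤ sum α → SwapSafe α τ j → SPCT α σ (s j τ)
swap-preserves-SPCT {α} {σ} {τ} {j} comp sp 1≤j j+1≤n safe = record
  { distinct = λ r c r′ c′ d d′ → SPCT.distinct sp r c r′ c′ d d′ ∘ swap-injective j
  ; positive = λ r c d → swap-positive 1≤j (SPCT.positive sp r c d)
  ; bounded  = λ r c d → swap-bounded j+1≤n (SPCT.bounded sp r c d)
  ; firstCol = swap-preserves-standardization j (firstColumn α τ) σ
                 (λ i k (τi≡j , τk≡j+1) →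
                    safe (inDiag-firstColumn comp i , τi≡j)
                         (inDiag-firstColumn comp k , τk≡j+1) (inj₁ refl))
                 (SPCT.firstCol sp)
  ; rowDecr  = λ r c d → swap-mono-≤ j (SPCT.rowDecr sp r c d)
                 (λ (τr[c+1]≡j , τrc≡j+1) →
                    safe (d , τr[c+1]≡j) (inDiag-left α d , τrc≡j+1) (inj₂ (inj₂ (refl , refl))))
  ; triple   = triple
  }
  where
  triple : ∀ i r c → i < r → InDiag α i (suc c) → InDiag α r (suc c) →
           s j τ r (suc c) ≤ s j τ i c → s j τ r (suc c) < s j τ i (suc c)
  triple i r c i<r dᵢ dᵣ swapped-c≤a = swap-mono-< j
      (SPCT.triple sp i r c i<r dᵢ dᵣ c≤a)
      (λ (τr[c+1]≡j , τi[c+1]≡j+1) → safe (dᵣ , τr[c+1]≡j) (dᵢ , τi[c+1]≡j+1) (inj₁ refl))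
    where
    c≤a : τ r (suc c) ≤ τ i c
    c≤a = swap-reflects-≤ j swapped-c≤a
      (λ (τr[c+1]≡j+1 , τic≡j) → safe (inDiag-left α dᵢ , τic≡j) (dᵣ , τr[c+1]≡j+1) (inj₂ (inj₁ (refl , i<r))))

des∧nonattacking⇒swapSafe : ∀ {α σ τ j} → SPCT α σ τ →
                            Des α τ j → Nonattacking α τ j → SwapSafe α τ j
des∧nonattacking⇒swapSafe sp (_ , _ , _ , _ , j-at₀ , j+1-at₀ , c₀≤c₀′) nonattacking j-at j+1-at =
  λ { (inj₁ c≡c′)                → nonattacking (_ , _ , _ , _ , j-at , j+1-at , inj₁ c≡c′)
    ; (inj₂ (inj₁ c′≡1+c,r<r′)) → nonattacking (_ , _ , _ , _ , j-at , j+1-at , inj₂ c′≡1+c,r<r′)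
    ; (inj₂ (inj₂ (c≡1+c′ , _))) → 1+n≰n (subst₂ _≤_
        (trans (sym (proj₂ (At-unique sp j-at j-at₀))) c≡1+c′)
        (sym (proj₂ (At-unique sp j+1-at j+1-at₀))) c₀≤c₀′) }

¬des∧¬jRightOf⇒swapSafe : ∀ {α τ j} → ¬ Des α τ j → ¬ JRightOfJ+1 α τ j → SwapSafe α τ j
¬des∧¬jRightOf⇒swapSafe ¬des ¬jRight j-at j+1-at =
  λ { (inj₁ c≡c′)                → ¬des (_ , _ , _ , _ , j-at , j+1-at , ≤-reflexive c≡c′)
    ; (inj₂ (inj₁ (refl , _)))   → ¬des (_ , _ , _ , _ , j-at , j+1-at , n≤1+n _)
    ; (inj₂ (inj₂ (refl , refl))) → ¬jRight (_ , _ , j+1-at , j-at) }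

lemma3p2 : (α : List ℕ) → IsComposition α → (σ : Permutation′ (ℓ α)) →
    (τ : Filling) → SPCT α σ τ → (j : ℕ) → 1 ≤ j → suc j ≤ sum α →
    ((Des α τ j → Nonattacking α τ j → SPCT α σ (s j τ)) ×
    (¬ Des α τ j → ¬ JRightOfJ+1 α τ j → SPCT α σ (s j τ)))
lemma3p2 α comp σ τ sp j 1≤j j+1≤n =
  (λ des nonattacking →
     swap-preserves-SPCT comp sp 1≤j j+1≤n (des∧nonattacking⇒swapSafe sp des nonattacking)) ,
  (λ ¬des ¬jRight →
     swap-preserves-SPCT comp sp 1≤j j+1≤n (¬des∧¬jRightOf⇒swapSafe {α} ¬des ¬jRight))
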